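{- Let $n=ab$, $V=\mathbb{Z}_n$, $U=\{0,a,\dots,(b-1)a\}$ the subgroup of order $b$, $\pi$ a permutation of $\{0,\dots,a-1\}$, $v_0,\dots,v_{a-1}\in U$, and let $Y$ be the permutation of $V$ given by $Y(i+u)=\pi(i)+u+v_i$ ($0\le i\le a-1$, $u\in U$). Fix $0\le i\le a-1$ and $u\in U$, let $c$ be the length of the cycle of $\pi$ containing $i$, let $v=v_i+v_{\pi(i)}+v_{\pi^2(i)}+\dots+v_{\pi^{c-1}(i)}$, and let $\alpha>0$ be the smallest positive integer with $\alpha v=0$ in $U$. Then the cycle of $Y$ containing $i+u$ has length $\alpha c$.
   Context: Every element of $V$ has a unique representation $i+u$ with $0\le i\le a-1$ and $u\in U$. -}

module Defs where

open import Data.Nat using (ℕ; zero; suc; _+_; _*_; _∸_; _<_; NonZero)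
open import Data.Nat.Properties using (m*n≢0)
open import Data.Nat.DivMod using (_mod_)
open import Data.Nat.Divisibility using (_∣_)
open import Data.Fin using (Fin; toℕ)
open import Data.Fin.Permutation using (Permutation′; _⟨$⟩ʳ_)
open import Data.Product using (_×_)
open import Relation.Binary.PropositionalEquality using (_≡_; _≢_)

iter : {A : Set} → (A → A) → ℕ → A → A
iter f zero    x = x
iter f (suc k) x = f (iter f k x)

CycleLength : {A : Set} → (A → A) → A → ℕ → Set
CycleLength f x k =
  (0 < k) × (iter f k x ≡ x) × (∀ m → 0 < m → m < k → iter f m x ≢ x)

V : (a b : ℕ) → Set
V a b = Fin (a * b)

module _ (a b : ℕ) {{na : NonZero a}} {{nb : NonZero b}} where

  private
    instance
      nab : NonZero (a * b)
      nab = m*n≢0 a b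

  addV : V a b → V a b → V a b
  addV x y = (toℕ x + toℕ y) mod (a * b)

  zeroV : V a b
  zeroV = 0 mod (a * b)

  mulV : ℕ → V a b → V a b
  mulV α x = iter (addV x) α zeroV

  InU : V a b → Set
  InU u = a ∣ toℕ u

  embed : Fin a → V a b
  embed i = toℕ i mod (a * b)

  -- Y(i + u) = π(i) + u + v_i, where x = i + u with i = x mod a, u = x - i ∈ U
  Y : Permutation′ a → (Fin a → V a b) → V a b → V a b
  Y π v x = addV (addV (embed (π ⟨$⟩ʳ i)) u) (v i)
    where
    i : Fin a
    i = toℕ x mod a
    u : V a b
    u = (toℕ x ∸ toℕ i) mod (a * b)

  cycleSum : Permutation′ a → (Fin a → V a b) → Fin a → ℕ → V a b
  cycleSum π v i zero    = zeroV
  cycleSum π v i (suc k) = addV (cycleSum π v i k) (v (iter (π ⟨$⟩ʳ_) k i))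

-- Every x ∈ ℤₙ decomposes uniquely as j + w with j < a and w ∈ U = aℤ/nℤ, and Y acts on
-- the two components separately: j ↦ π j and w ↦ w + v_j.  Hence
-- Y^m(i + u) = π^m(i) + (u + s_m) with s_m = v_i + v_{π i} + ⋯ + v_{π^{m-1} i}, so Y^m fixes
-- i + u exactly when π^m i = i and s_m = 0.  The first condition forces m = q c, and then
-- s_m = q v because the sum is periodic along the cycle of π; so the least such m is α c.
module Submission where

open import Defs
open import Data.Nat using (ℕ; zero; suc; _+_; _*_; _∸_; _<_; _≤_; _%_; _/_; NonZero; z<s; >-nonZero; >-nonZero⁻¹)
open import Data.Nat.Properties
open import Data.Nat.DivMod
open import Data.Nat.Divisibility using (_∣_; divides; _∣0; ∣m∣n⇒∣m+n; m∣m*n; %-presˡ-∣)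
open import Data.Fin using (Fin; toℕ)
open import Data.Fin.Properties using (toℕ-injective; toℕ<n; toℕ-fromℕ<)
open import Data.Fin.Permutation using (Permutation′; _⟨$⟩ʳ_)
open import Data.Product using (_×_; _,_)
open import Relation.Binary.PropositionalEquality
open import Relation.Nullary using (contradiction)

module _ {A : Set} (f : A → A) where

  iter-+ : ∀ m k x → iter f (m + k) x ≡ iter f m (iter f k x)
  iter-+ zero    k x = refl
  iter-+ (suc m) k x = cong f (iter-+ m k x)

  iter-periodic : ∀ k {x} → iter f k x ≡ x → ∀ q → iter f (q * k) x ≡ x
  iter-periodic k fᵏx≡x zero    = refl
  iter-periodic k {x} fᵏx≡x (suc q) = begin
    iter f (k + q * k) x        ≡⟨ iter-+ k (q * k) x ⟩
    iter f k (iter f (q * k) x) ≡⟨ cong (iter f k) (iter-periodic k fᵏx≡x q) ⟩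
    iter f k x                  ≡⟨ fᵏx≡x ⟩
    x                           ∎
    where open ≡-Reasoning

  cycleLength-∣ : ∀ {x c} m → CycleLength f x c → iter f m x ≡ x → c ∣ m
  cycleLength-∣ {x} {c} m (0<c , fᶜx≡x , minimal) fᵐx≡x = divides (m / c) m≡qc
    where
    instance
      c≢0 : NonZero c
      c≢0 = >-nonZero 0<c

    fʳx≡x : iter f (m % c) x ≡ x
    fʳx≡x = begin
      iter f (m % c) x                           ≡⟨ cong (iter f (m % c)) (iter-periodic c fᶜx≡x (m / c)) ⟨
      iter f (m % c) (iter f (m / c * c) x)      ≡⟨ iter-+ (m % c) (m / c * c) x ⟨
      iter f (m % c + m / c * c) x               ≡⟨ cong (λ k → iter f k x) (m≡m%n+[m/n]*n m c) ⟨
      iter f m x                                 ≡⟨ fᵐx≡x ⟩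
      x                                          ∎
      where open ≡-Reasoning

    r≡0 : ∀ r → r < c → iter f r x ≡ x → r ≡ 0
    r≡0 zero    _   _    = refl
    r≡0 (suc r) r<c fʳx≡x = contradiction fʳx≡x (minimal (suc r) z<s r<c)

    m≡qc : m ≡ m / c * c
    m≡qc = trans (m≡m%n+[m/n]*n m c) (cong (_+ m / c * c) (r≡0 (m % c) (m%n<n m c) fʳx≡x))

  cycleLength-intro : ∀ {x k} → 0 < k → iter f k x ≡ x →
                      (∀ m → 0 < m → iter f m x ≡ x → k ≤ m) → CycleLength f x k
  cycleLength-intro 0<k fᵏx≡x least =
    0<k , fᵏx≡x , λ m 0<m m<k fᵐx≡x → <⇒≱ m<k (least m 0<m fᵐx≡x)

module _ {d : ℕ} {{_ : NonZero d}} where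

  [m%d+n]%d≡[m+n]%d : ∀ m n → (m % d + n) % d ≡ (m + n) % d
  [m%d+n]%d≡[m+n]%d m n = begin
    (m % d + n) % d         ≡⟨ %-distribˡ-+ (m % d) n d ⟩
    (m % d % d + n % d) % d ≡⟨ cong (λ k → (k + n % d) % d) (m%n%n≡m%n m d) ⟩
    (m % d + n % d) % d     ≡⟨ %-distribˡ-+ m n d ⟨
    (m + n) % d             ∎
    where open ≡-Reasoning

  [m+n%d]%d≡[m+n]%d : ∀ m n → (m + n % d) % d ≡ (m + n) % d
  [m+n%d]%d≡[m+n]%d m n = begin
    (m + n % d) % d ≡⟨ %-congˡ (+-comm m (n % d)) ⟩
    (n % d + m) % d ≡⟨ [m%d+n]%d≡[m+n]%d n m ⟩
    (n + m) % d     ≡⟨ %-congˡ (+-comm n m) ⟩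
    (m + n) % d     ∎
    where open ≡-Reasoning

  toℕ-mod : ∀ m → toℕ (m mod d) ≡ m % d
  toℕ-mod m = toℕ-fromℕ< _

  mod-cong : ∀ {m k} → m % d ≡ k % d → m mod d ≡ k mod d
  mod-cong {m} {k} eq = toℕ-injective (trans (toℕ-mod m) (trans eq (sym (toℕ-mod k))))

m<d⇒m+n<o : ∀ {d m n o} → m < d → d ∣ n → d ∣ o → n < o → m + n < o
m<d⇒m+n<o {d} {m} {o = o} m<d (divides k refl) (divides l refl) kd<ld = begin-strict
  m + k * d     <⟨ +-monoˡ-< (k * d) m<d ⟩
  d + k * d     ≤⟨ *-monoˡ-≤ d (*-cancelʳ-< d k l kd<ld) ⟩
  l * d         ∎
  where open ≤-Reasoning

module _ (a b : ℕ) {{_ : NonZero a}} {{_ : NonZero b}} where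

  private
    n : ℕ
    n = a * b

    instance
      n≢0 : NonZero n
      n≢0 = m*n≢0 a b

    infixl 6 _⊕_
    _⊕_ : V a b → V a b → V a b
    _⊕_ = addV a b

    𝟘 : V a b
    𝟘 = zeroV a b

    ⊖_ : V a b → V a b
    ⊖ x = (n ∸ toℕ x) mod n

  toℕ-⊕ : ∀ x y → toℕ (x ⊕ y) ≡ (toℕ x + toℕ y) % n
  toℕ-⊕ x y = toℕ-mod (toℕ x + toℕ y)

  toℕ-𝟘 : toℕ 𝟘 ≡ 0
  toℕ-𝟘 = trans (toℕ-mod 0) (m<n⇒m%n≡m (>-nonZero⁻¹ n))

  ⊕-comm : ∀ x y → x ⊕ y ≡ y ⊕ x
  ⊕-comm x y = cong (_mod n) (+-comm (toℕ x) (toℕ y))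

  ⊕-assoc : ∀ x y z → (x ⊕ y) ⊕ z ≡ x ⊕ (y ⊕ z)
  ⊕-assoc x y z = mod-cong (begin
    (toℕ (x ⊕ y) + toℕ z) % n           ≡⟨ %-congˡ (cong (_+ toℕ z) (toℕ-⊕ x y)) ⟩
    ((toℕ x + toℕ y) % n + toℕ z) % n   ≡⟨ [m%d+n]%d≡[m+n]%d (toℕ x + toℕ y) (toℕ z) ⟩
    (toℕ x + toℕ y + toℕ z) % n         ≡⟨ %-congˡ (+-assoc (toℕ x) (toℕ y) (toℕ z)) ⟩
    (toℕ x + (toℕ y + toℕ z)) % n       ≡⟨ [m+n%d]%d≡[m+n]%d (toℕ x) (toℕ y + toℕ z) ⟨
    (toℕ x + (toℕ y + toℕ z) % n) % n   ≡⟨ %-congˡ (cong (toℕ x +_) (toℕ-⊕ y z)) ⟨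
    (toℕ x + toℕ (y ⊕ z)) % n           ∎)
    where open ≡-Reasoning

  ⊕-identityʳ : ∀ x → x ⊕ 𝟘 ≡ x
  ⊕-identityʳ x = toℕ-injective (begin
    toℕ (x ⊕ 𝟘)           ≡⟨ toℕ-⊕ x 𝟘 ⟩
    (toℕ x + toℕ 𝟘) % n   ≡⟨ %-congˡ (cong (toℕ x +_) toℕ-𝟘) ⟩
    (toℕ x + 0) % n       ≡⟨ %-congˡ (+-identityʳ (toℕ x)) ⟩
    toℕ x % n             ≡⟨ m<n⇒m%n≡m (toℕ<n x) ⟩
    toℕ x                 ∎)
    where open ≡-Reasoning

  ⊕-identityˡ : ∀ x → 𝟘 ⊕ x ≡ x
  ⊕-identityˡ x = trans (⊕-comm 𝟘 x) (⊕-identityʳ x)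

  ⊕-inverseˡ : ∀ x → ⊖ x ⊕ x ≡ 𝟘
  ⊕-inverseˡ x = mod-cong (begin
    (toℕ (⊖ x) + toℕ x) % n           ≡⟨ %-congˡ (cong (_+ toℕ x) (toℕ-mod {d = n} (n ∸ toℕ x))) ⟩
    ((n ∸ toℕ x) % n + toℕ x) % n     ≡⟨ [m%d+n]%d≡[m+n]%d (n ∸ toℕ x) (toℕ x) ⟩
    (n ∸ toℕ x + toℕ x) % n           ≡⟨ %-congˡ (m∸n+n≡m (<⇒≤ (toℕ<n x))) ⟩
    n % n                             ≡⟨ n%n≡0 n ⟩
    0                                 ≡⟨ m<n⇒m%n≡m (>-nonZero⁻¹ n) ⟨
    0 % n                             ∎)
    where open ≡-Reasoning

  ⊕-cancelˡ : ∀ x {y z} → x ⊕ y ≡ x ⊕ z → y ≡ z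
  ⊕-cancelˡ x {y} {z} eq = begin
    y                ≡⟨ ⊖x⊕[x⊕w]≡w y ⟨
    ⊖ x ⊕ (x ⊕ y)    ≡⟨ cong (⊖ x ⊕_) eq ⟩
    ⊖ x ⊕ (x ⊕ z)    ≡⟨ ⊖x⊕[x⊕w]≡w z ⟩
    z                ∎
    where
    open ≡-Reasoning
    ⊖x⊕[x⊕w]≡w : ∀ w → ⊖ x ⊕ (x ⊕ w) ≡ w
    ⊖x⊕[x⊕w]≡w w = begin
      ⊖ x ⊕ (x ⊕ w) ≡⟨ ⊕-assoc (⊖ x) x w ⟨
      (⊖ x ⊕ x) ⊕ w ≡⟨ cong (_⊕ w) (⊕-inverseˡ x) ⟩
      𝟘 ⊕ w         ≡⟨ ⊕-identityˡ w ⟩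
      w             ∎

  InU-𝟘 : InU a b 𝟘
  InU-𝟘 = subst (a ∣_) (sym toℕ-𝟘) (a ∣0)

  InU-⊕ : ∀ {x y} → InU a b x → InU a b y → InU a b (x ⊕ y)
  InU-⊕ {x} {y} x∈U y∈U =
    subst (a ∣_) (sym (toℕ-⊕ x y)) (%-presˡ-∣ (∣m∣n⇒∣m+n x∈U y∈U) (m∣m*n b))

  toℕ-embed : ∀ j → toℕ (embed a b j) ≡ toℕ j
  toℕ-embed j = trans (toℕ-mod (toℕ j)) (m<n⇒m%n≡m (<-≤-trans (toℕ<n j) (m≤m*n a b)))

  toℕ-embed⊕ : ∀ j {w} → InU a b w → toℕ (embed a b j ⊕ w) ≡ toℕ j + toℕ w
  toℕ-embed⊕ j {w} w∈U = begin
    toℕ (embed a b j ⊕ w)             ≡⟨ toℕ-⊕ (embed a b j) w ⟩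
    (toℕ (embed a b j) + toℕ w) % n   ≡⟨ %-congˡ (cong (_+ toℕ w) (toℕ-embed j)) ⟩
    (toℕ j + toℕ w) % n               ≡⟨ m<n⇒m%n≡m (m<d⇒m+n<o (toℕ<n j) w∈U (m∣m*n b) (toℕ<n w)) ⟩
    toℕ j + toℕ w                     ∎
    where open ≡-Reasoning

  toℕ-embed⊕-%a : ∀ j {w} → InU a b w → toℕ (embed a b j ⊕ w) % a ≡ toℕ j
  toℕ-embed⊕-%a j {w} w∈U = begin
    toℕ (embed a b j ⊕ w) % a   ≡⟨ %-congˡ (toℕ-embed⊕ j w∈U) ⟩
    (toℕ j + toℕ w) % a         ≡⟨ %-remove-+ʳ (toℕ j) w∈U ⟩
    toℕ j % a                   ≡⟨ m<n⇒m%n≡m (toℕ<n j) ⟩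
    toℕ j                       ∎
    where open ≡-Reasoning

  embed⊕-injective : ∀ {j j′ w w′} → InU a b w → InU a b w′ →
                     embed a b j ⊕ w ≡ embed a b j′ ⊕ w′ → j ≡ j′ × w ≡ w′
  embed⊕-injective {j} {j′} {w} {w′} w∈U w′∈U eq
    with toℕ-injective (trans (sym (toℕ-embed⊕-%a j w∈U))
                       (trans (cong (λ x → toℕ x % a) eq) (toℕ-embed⊕-%a j′ w′∈U)))
  ... | refl = refl , toℕ-injective (+-cancelˡ-≡ (toℕ j) (toℕ w) (toℕ w′)
                        (trans (sym (toℕ-embed⊕ j w∈U)) (trans (cong toℕ eq) (toℕ-embed⊕ j w′∈U))))

  Y-embed⊕ : ∀ π v j {w} → InU a b w →
             Y a b π v (embed a b j ⊕ w) ≡ embed a b (π ⟨$⟩ʳ j) ⊕ (w ⊕ v j)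
  Y-embed⊕ π v j {w} w∈U = begin
    Y a b π v x                                                 ≡⟨⟩
    embed a b (π ⟨$⟩ʳ j′) ⊕ (toℕ x ∸ toℕ j′) mod n ⊕ v j′       ≡⟨ cong (λ k → embed a b (π ⟨$⟩ʳ k) ⊕ (toℕ x ∸ toℕ k) mod n ⊕ v k) j′≡j ⟩
    embed a b (π ⟨$⟩ʳ j) ⊕ (toℕ x ∸ toℕ j) mod n ⊕ v j          ≡⟨ cong (λ w′ → embed a b (π ⟨$⟩ʳ j) ⊕ w′ ⊕ v j) w′≡w ⟩
    embed a b (π ⟨$⟩ʳ j) ⊕ w ⊕ v j                              ≡⟨ ⊕-assoc (embed a b (π ⟨$⟩ʳ j)) w (v j) ⟩
    embed a b (π ⟨$⟩ʳ j) ⊕ (w ⊕ v j)                            ∎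
    where
    open ≡-Reasoning
    x : V a b
    x = embed a b j ⊕ w
    j′ : Fin a
    j′ = toℕ x mod a
    j′≡j : j′ ≡ j
    j′≡j = toℕ-injective (trans (toℕ-mod (toℕ x)) (toℕ-embed⊕-%a j w∈U))
    w′≡w : (toℕ x ∸ toℕ j) mod n ≡ w
    w′≡w = toℕ-injective (begin
      toℕ ((toℕ x ∸ toℕ j) mod n)   ≡⟨ toℕ-mod (toℕ x ∸ toℕ j) ⟩
      (toℕ x ∸ toℕ j) % n           ≡⟨ %-congˡ (cong (_∸ toℕ j) (toℕ-embed⊕ j w∈U)) ⟩
      (toℕ j + toℕ w ∸ toℕ j) % n   ≡⟨ %-congˡ (m+n∸m≡n (toℕ j) (toℕ w)) ⟩
      toℕ w % n                     ≡⟨ m<n⇒m%n≡m (toℕ<n w) ⟩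
      toℕ w                         ∎)

  module Orbit (π : Permutation′ a) (v : Fin a → V a b) (v∈U : ∀ j → InU a b (v j))
               (i : Fin a) (u : V a b) (u∈U : InU a b u) where

    private
      P : Fin a → Fin a
      P = π ⟨$⟩ʳ_

      s : ℕ → V a b
      s = cycleSum a b π v i

    x₀ : V a b
    x₀ = embed a b i ⊕ u

    cycleSum∈U : ∀ m → InU a b (s m)
    cycleSum∈U zero    = InU-𝟘
    cycleSum∈U (suc m) = InU-⊕ (cycleSum∈U m) (v∈U _)

    cycleSum-+ : ∀ c → iter P c i ≡ i → ∀ m → s (m + c) ≡ s m ⊕ s c
    cycleSum-+ c Pᶜi≡i zero    = sym (⊕-identityˡ (s c))
    cycleSum-+ c Pᶜi≡i (suc m) = begin
      s (m + c) ⊕ v (iter P (m + c) i)     ≡⟨ cong₂ _⊕_ (cycleSum-+ c Pᶜi≡i m) (cong v Pᵐ⁺ᶜi≡Pᵐi) ⟩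
      s m ⊕ s c ⊕ v (iter P m i)           ≡⟨ ⊕-assoc (s m) (s c) _ ⟩
      s m ⊕ (s c ⊕ v (iter P m i))         ≡⟨ cong (s m ⊕_) (⊕-comm (s c) _) ⟩
      s m ⊕ (v (iter P m i) ⊕ s c)         ≡⟨ ⊕-assoc (s m) _ (s c) ⟨
      s m ⊕ v (iter P m i) ⊕ s c           ∎
      where
      open ≡-Reasoning
      Pᵐ⁺ᶜi≡Pᵐi : iter P (m + c) i ≡ iter P m i
      Pᵐ⁺ᶜi≡Pᵐi = trans (iter-+ P m c i) (cong (iter P m) Pᶜi≡i)

    cycleSum-* : ∀ c → iter P c i ≡ i → ∀ q → s (q * c) ≡ mulV a b q (s c)
    cycleSum-* c Pᶜi≡i zero    = refl
    cycleSum-* c Pᶜi≡i (suc q) = begin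
      s (c + q * c)                ≡⟨ cong s (+-comm c (q * c)) ⟩
      s (q * c + c)                ≡⟨ cycleSum-+ c Pᶜi≡i (q * c) ⟩
      s (q * c) ⊕ s c              ≡⟨ cong (_⊕ s c) (cycleSum-* c Pᶜi≡i q) ⟩
      mulV a b q (s c) ⊕ s c       ≡⟨ ⊕-comm _ (s c) ⟩
      s c ⊕ mulV a b q (s c)       ∎
      where open ≡-Reasoning

    iter-Y : ∀ m → iter (Y a b π v) m x₀ ≡ embed a b (iter P m i) ⊕ (u ⊕ s m)
    iter-Y zero    = cong (embed a b i ⊕_) (sym (⊕-identityʳ u))
    iter-Y (suc m) = begin
      Y a b π v (iter (Y a b π v) m x₀)                   ≡⟨ cong (Y a b π v) (iter-Y m) ⟩
      Y a b π v (embed a b (iter P m i) ⊕ (u ⊕ s m))      ≡⟨ Y-embed⊕ π v (iter P m i) (InU-⊕ u∈U (cycleSum∈U m)) ⟩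
      embed a b (iter P (suc m) i) ⊕ (u ⊕ s m ⊕ v _)      ≡⟨ cong (embed a b _ ⊕_) (⊕-assoc u (s m) _) ⟩
      embed a b (iter P (suc m) i) ⊕ (u ⊕ s (suc m))      ∎
      where open ≡-Reasoning

    Y-returns⇒ : ∀ m → iter (Y a b π v) m x₀ ≡ x₀ → iter P m i ≡ i × s m ≡ 𝟘
    Y-returns⇒ m Yᵐx₀≡x₀ with embed⊕-injective (InU-⊕ u∈U (cycleSum∈U m)) u∈U
                                  (trans (sym (iter-Y m)) Yᵐx₀≡x₀)
    ... | Pᵐi≡i , u⊕sm≡u = Pᵐi≡i , ⊕-cancelˡ u (trans u⊕sm≡u (sym (⊕-identityʳ u)))

    Y-returns⇐ : ∀ m → iter P m i ≡ i → s m ≡ 𝟘 → iter (Y a b π v) m x₀ ≡ x₀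
    Y-returns⇐ m Pᵐi≡i sm≡𝟘 = begin
      iter (Y a b π v) m x₀               ≡⟨ iter-Y m ⟩
      embed a b (iter P m i) ⊕ (u ⊕ s m)  ≡⟨ cong₂ (λ j w → embed a b j ⊕ (u ⊕ w)) Pᵐi≡i sm≡𝟘 ⟩
      embed a b i ⊕ (u ⊕ 𝟘)               ≡⟨ cong (embed a b i ⊕_) (⊕-identityʳ u) ⟩
      x₀                                  ∎
      where open ≡-Reasoning

lemma12 : (a b : ℕ) {{na : NonZero a}} {{nb : NonZero b}}
    (π : Permutation′ a) (v : Fin a → V a b) → (∀ j → InU a b (v j)) →
    (i : Fin a) (u : V a b) → InU a b u →
    (c : ℕ) → CycleLength (π ⟨$⟩ʳ_) i c →
    (α : ℕ) → 0 < α → mulV a b α (cycleSum a b π v i c) ≡ zeroV a b →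
    (∀ β → 0 < β → β < α → mulV a b β (cycleSum a b π v i c) ≢ zeroV a b) →
    CycleLength (Y a b π v) (addV a b (embed a b i) u) (α * c)
lemma12 a b π v v∈U i u u∈U c cyc@(0<c , πᶜi≡i , _) α 0<α αs≡0 α-least =
  cycleLength-intro (Y a b π v) (*-mono-< 0<α 0<c)
    (Y-returns⇐ (α * c) (iter-periodic (π ⟨$⟩ʳ_) c πᶜi≡i α) (trans (cycleSum-* c πᶜi≡i α) αs≡0))
    αc-least
  where
  open Orbit a b π v v∈U i u u∈U

  αc-least : ∀ m → 0 < m → iter (Y a b π v) m x₀ ≡ x₀ → α * c ≤ m
  αc-least m 0<m Yᵐx₀≡x₀ with Y-returns⇒ m Yᵐx₀≡x₀
  ... | πᵐi≡i , sm≡0 with cycleLength-∣ (π ⟨$⟩ʳ_) m cyc πᵐi≡i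
  ... | divides zero    refl = contradiction 0<m (<-irrefl refl)
  ... | divides q@(suc _) refl =
    *-monoˡ-≤ c (≮⇒≥ λ q<α → α-least q z<s q<α (trans (sym (cycleSum-* c πᶜi≡i q)) sm≡0))
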